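{- For any closed term $M$ and any $n,N\in\mathbb N$: if $M\Downarrow_n X$ and $M\Downarrow_{n+N} Y$ then $X\sqsubseteq Y$.
   Context: $\Sigma$ is a signature. $T$ is a monad on sets (unit $\eta$, bind $\gg\!=$) carrying a continuous $\Sigma$-algebra structure: each $TX$ is an $\omega$CPPO $(TX,\sqsubseteq,\bot)$ (poset with least element and lubs of $\omega$-chains), bind is continuous (in particular monotone) in both arguments, and each $\sigma\in\Sigma$ of arity $k$ is interpreted as a continuous map $\sigma^T:(TX)^k\to TX$. Terms and values: $M,N ::= \mathsf{return}\,V\mid VW\mid M\ \mathsf{to}\ x.N\mid\sigma(M_1,\dots,M_k)$, $V,W::=x\mid\lambda x.M$; $\mathcal V_0$ closed values. Judgments $M\Downarrow_n X$ (closed $M$, $X\in T\mathcal V_0$) are the least relation closed under: $M\Downarrow_0\bot$; $\mathsf{return}\,V\Downarrow_{n+1}\eta(V)$; $M[V/x]\Downarrow_n X\Rightarrow(\lambda x.M)V\Downarrow_{n+1}X$; $M\Downarrow_n X$ and $N[V/x]\Downarrow_n Y_V$ for all closed $V$ $\Rightarrow(M\ \mathsf{to}\ x.N)\Downarrow_{n+1}X\gg\!=(V\mapsto Y_V)$; $M_i\Downarrow_n X_i$ ($i\le k$) $\Rightarrow\sigma(M_1,\dots,M_k)\Downarrow_{n+1}\sigma^T(X_1,\dots,X_k)$. -}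

module Defs where

open import Data.Nat using (ℕ; zero; suc)
open import Data.Fin using (Fin; zero; suc)
open import Relation.Binary.PropositionalEquality using (_≡_)

record Signature : Set₁ where
  field
    Op : Set
    ar : Op → ℕ

-- Syntax (well-scoped de Bruijn terms; Tm n / Val n have n free variables)

module _ (Sg : Signature) where
  open Signature Sg

  mutual
    data Val (n : ℕ) : Set where
      var : Fin n → Val n
      lam : Tm (suc n) → Val n

    data Tm (n : ℕ) : Set where
      ret : Val n → Tm n
      app : Val n → Val n → Tm n
      _to_ : Tm n → Tm (suc n) → Tm n        -- M to x. N  (x bound in N)
      op  : (o : Op) → (Fin (ar o) → Tm n) → Tm n

  Val₀ : Set
  Val₀ = Val 0

  ext : ∀ {n m} → (Fin n → Fin m) → Fin (suc n) → Fin (suc m)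
  ext ρ zero    = zero
  ext ρ (suc i) = suc (ρ i)

  mutual
    renV : ∀ {n m} → (Fin n → Fin m) → Val n → Val m
    renV ρ (var i) = var (ρ i)
    renV ρ (lam M) = lam (renT (ext ρ) M)

    renT : ∀ {n m} → (Fin n → Fin m) → Tm n → Tm m
    renT ρ (ret V)   = ret (renV ρ V)
    renT ρ (app V W) = app (renV ρ V) (renV ρ W)
    renT ρ (M to N)  = renT ρ M to renT (ext ρ) N
    renT ρ (op o Ms) = op o (λ i → renT ρ (Ms i))

  exts : ∀ {n m} → (Fin n → Val m) → Fin (suc n) → Val (suc m)
  exts σ zero    = var zero
  exts σ (suc i) = renV suc (σ i)

  mutual
    subV : ∀ {n m} → (Fin n → Val m) → Val n → Val m
    subV σ (var i) = σ i
    subV σ (lam M) = lam (subT (exts σ) M)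

    subT : ∀ {n m} → (Fin n → Val m) → Tm n → Tm m
    subT σ (ret V)   = ret (subV σ V)
    subT σ (app V W) = app (subV σ V) (subV σ W)
    subT σ (M to N)  = subT σ M to subT (exts σ) N
    subT σ (op o Ms) = op o (λ i → subT σ (Ms i))


_[_/x] : ∀ {Sg} → Tm Sg 1 → Val₀ Sg → Tm Sg 0
M [ V /x] = subT _ (λ _ → V) M

record ContinuousAlgebra (Sg : Signature) : Set₁ where
  open Signature Sg
  field
    T    : Set → Set
    η    : ∀ {X} → X → T X
    _>>=_ : ∀ {X Y} → T X → (X → T Y) → T Y
    unitˡ : ∀ {X Y} (x : X) (f : X → T Y) → (η x >>= f) ≡ f x
    unitʳ : ∀ {X} (m : T X) → (m >>= η) ≡ m
    assoc : ∀ {X Y Z} (m : T X) (f : X → T Y) (g : Y → T Z) →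
            ((m >>= f) >>= g) ≡ (m >>= (λ x → f x >>= g))

    _⊑_      : ∀ {X} → T X → T X → Set
    ⊑-refl   : ∀ {X} {a : T X} → a ⊑ a
    ⊑-trans  : ∀ {X} {a b c : T X} → a ⊑ b → b ⊑ c → a ⊑ c
    ⊑-antisym : ∀ {X} {a b : T X} → a ⊑ b → b ⊑ a → a ≡ b
    ⊥T       : ∀ {X} → T X
    ⊥-least  : ∀ {X} (a : T X) → ⊥T ⊑ a
    ⨆        : ∀ {X} (c : ℕ → T X) → (∀ n → c n ⊑ c (suc n)) → T X
    ⨆-upper  : ∀ {X} (c : ℕ → T X) (p : ∀ n → c n ⊑ c (suc n)) →
               ∀ n → c n ⊑ ⨆ c p
    ⨆-least  : ∀ {X} (c : ℕ → T X) (p : ∀ n → c n ⊑ c (suc n)) (u : T X) →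
               (∀ n → c n ⊑ u) → ⨆ c p ⊑ u

    bind-monoˡ : ∀ {X Y} {m m' : T X} (f : X → T Y) →
                 m ⊑ m' → (m >>= f) ⊑ (m' >>= f)
    bind-monoʳ : ∀ {X Y} (m : T X) {f g : X → T Y} →
                 (∀ x → f x ⊑ g x) → (m >>= f) ⊑ (m >>= g)
    bind-contˡ : ∀ {X Y} (c : ℕ → T X) (p : ∀ n → c n ⊑ c (suc n))
                 (f : X → T Y) →
                 (⨆ c p >>= f) ≡ ⨆ (λ n → c n >>= f) (λ n → bind-monoˡ f (p n))
    bind-contʳ : ∀ {X Y} (m : T X) (c : ℕ → X → T Y)
                 (p : ∀ n x → c n x ⊑ c (suc n) x) →
                 (m >>= (λ x → ⨆ (λ n → c n x) (λ n → p n x)))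
                   ≡ ⨆ (λ n → m >>= c n) (λ n → bind-monoʳ m (p n))

    opT      : ∀ {X} (o : Op) → (Fin (ar o) → T X) → T X
    opT-mono : ∀ {X} (o : Op) {as bs : Fin (ar o) → T X} →
               (∀ i → as i ⊑ bs i) → opT o as ⊑ opT o bs
    opT-cont : ∀ {X} (o : Op) (c : ℕ → Fin (ar o) → T X)
               (p : ∀ n i → c n i ⊑ c (suc n) i) →
               opT o (λ i → ⨆ (λ n → c n i) (λ n → p n i))
                 ≡ ⨆ (λ n → opT o (c n)) (λ n → opT-mono o (p n))

module _ {Sg : Signature} (A : ContinuousAlgebra Sg) where
  open Signature Sg
  open ContinuousAlgebra A

  data _⇓[_]_ : Tm Sg 0 → ℕ → T (Val₀ Sg) → Set where
    ⇓-zero : ∀ {M} → M ⇓[ 0 ] ⊥T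
    ⇓-ret  : ∀ {V n} → ret V ⇓[ suc n ] η V
    ⇓-app  : ∀ {M V n X} → (M [ V /x]) ⇓[ n ] X → app (lam M) V ⇓[ suc n ] X
    ⇓-to   : ∀ {M N n X} {Y : Val₀ Sg → T (Val₀ Sg)} →
             M ⇓[ n ] X → (∀ V → (N [ V /x]) ⇓[ n ] Y V) →
             (M to N) ⇓[ suc n ] (X >>= Y)
    ⇓-op   : ∀ {o Ms n} {Xs : Fin (ar o) → T (Val₀ Sg)} →
             (∀ i → Ms i ⇓[ n ] Xs i) → op o Ms ⇓[ suc n ] opT o Xs

module Submission where

-- The proof is a single induction on the shorter derivation M ⇓ₙ X, taken
-- simultaneously with a longer derivation M ⇓ₘ Y (n ≤ m) of the same term.
-- If n = 0 then X = ⊥ and there is nothing to show.  Otherwise both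
-- derivations end with the rule determined by the shape of M, their premises
-- live at indices n-1 ≤ m-1, and the conclusion follows from the induction
-- hypothesis together with monotonicity of the operation building the result:
-- the identity for application, bind (monotone in both arguments) for
-- sequencing, and σᵀ for operations.

open import Defs
open import Data.Nat using (ℕ; _+_; _≤_; s≤s)
open import Data.Nat.Properties using (m≤m+n)

module _ {Sg : Signature} (A : ContinuousAlgebra Sg) where
  open ContinuousAlgebra A

  bind-mono : ∀ {X Y} {m m' : T X} {f g : X → T Y} →
              m ⊑ m' → (∀ x → f x ⊑ g x) → (m >>= f) ⊑ (m' >>= g)
  bind-mono {m' = m'} {f = f} m⊑m' f⊑g =
    ⊑-trans (bind-monoˡ f m⊑m') (bind-monoʳ m' f⊑g)

  ⇓-mono : ∀ {M n m X Y} → _⇓[_]_ A M n X → _⇓[_]_ A M m Y → n ≤ m → X ⊑ Y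
  ⇓-mono ⇓-zero        _             _       = ⊥-least _
  ⇓-mono ⇓-ret         ⇓-ret         _       = ⊑-refl
  ⇓-mono (⇓-app d)     (⇓-app e)     (s≤s le) = ⇓-mono d e le
  ⇓-mono (⇓-to d ds)   (⇓-to e es)   (s≤s le) =
    bind-mono (⇓-mono d e le) (λ V → ⇓-mono (ds V) (es V) le)
  ⇓-mono (⇓-op ds)     (⇓-op es)     (s≤s le) =
    opT-mono _ (λ i → ⇓-mono (ds i) (es i) le)

mainTheorem11 : (Sg : Signature) (A : ContinuousAlgebra Sg) →
    (M : Tm Sg 0) (n N : ℕ) (X Y : ContinuousAlgebra.T A (Val₀ Sg)) →
    _⇓[_]_ A M n X → _⇓[_]_ A M (n + N) Y → ContinuousAlgebra._⊑_ A X Y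
mainTheorem11 Sg A M n N X Y M⇓X M⇓Y = ⇓-mono A M⇓X M⇓Y (m≤m+n n N)
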